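{- In conjunctive compound Node-Kayles under normal play, the set $\mathcal{L}$ of integers $n\ge 0$ such that the single path $P_n$ is a $\mathcal{P}$-position is $\mathcal{L}=\{0,4,5,9,10\}$.
   Context: For $n\ge 0$, $P_n$ denotes the path on $n$ vertices ($P_0$ is the empty graph). A Node-Kayles move on a path $P_k$ with $k\ge 1$ chooses a vertex and deletes it together with its neighbours. The possible results are: $P_0$ if $k\in\{1,2\}$; $P_0$ or $P_1$ if $k=3$; and, for $k\ge 4$, $P_{k-2}$, $P_{k-3}$, or two paths $P_i,P_j$ with $j\ge i\ge1$, $i+j=k-3$. Conjunctive compound Node-Kayles is played by two players who move alternately, starting from a single path. A position is a finite multiset of paths (components). A move consists in replacing every component simultaneously by the result of a Node-Kayles move on it; a split component yields two components. The game ends as soon as some component is the empty path $P_0$, since no move is then possible (short ending rule). Under normal play, the player who made the last move wins. A position is a $\mathcal{P}$-position if the second player (the one not moving next) has a winning strategy, and an $\mathcal{N}$-position otherwise. In particular, $P_0$ is a $\mathcal{P}$-position. -}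

module Defs where

open import Data.Nat using (ℕ; zero; suc; _+_; _≤_)
open import Data.List using (List; []; _∷_; _++_)
open import Data.Product using (Σ; _×_)
open import Data.Sum using (_⊎_)
open import Relation.Binary.PropositionalEquality using (_≡_)

-- A position is a finite multiset of paths, represented by the list of
-- their numbers of vertices (order is irrelevant for the game).
Position : Set
Position = List ℕ

-- Node-Kayles move on a single path P_k: KMove k r means that P_k can
-- be turned into the components listed in r (P_0 is represented as 0).
data KMove : ℕ → List ℕ → Set where
  k1    : KMove 1 (0 ∷ [])
  k2    : KMove 2 (0 ∷ [])
  k3-0  : KMove 3 (0 ∷ [])
  k3-1  : KMove 3 (1 ∷ [])
  k-2   : ∀ m → KMove (4 + m) ((2 + m) ∷ [])
  k-3   : ∀ m → KMove (4 + m) ((1 + m) ∷ [])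
  split : ∀ m i j → 1 ≤ i → i ≤ j → i + j ≡ 1 + m →
          KMove (4 + m) (i ∷ j ∷ [])

-- A position containing P_0 has no
-- move (KMove 0 _ is empty), i.e. the short ending rule.
data Move : Position → Position → Set where
  []  : Move [] []
  _∷_ : ∀ {k r ks rs} → KMove k r → Move ks rs → Move (k ∷ ks) (r ++ rs)

-- Normal play: the player who cannot move loses.
data IsP (x : Position) : Set
data IsN (x : Position) : Set

data IsP x where
  p : (∀ y → Move x y → IsN y) → IsP x

data IsN x where
  n : ∀ y → Move x y → IsP y → IsN x

InL : ℕ → Set
InL k = k ≡ 0 ⊎ k ≡ 4 ⊎ k ≡ 5 ⊎ k ≡ 9 ⊎ k ≡ 10

-- Paths P_1, P_2, P_3 can be emptied in one move, so any position having
-- one of them beside only non-empty paths is an N-position.  From P_{4+m}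
-- with m ≤ 6 every move reaches P_{2+m}, P_{1+m}, or a split whose shorter
-- part has at most 3 vertices; this makes P_4, P_5, P_9, P_10 P-positions
-- once P_1, P_2, P_3, P_6, P_7, P_8 are known to be N.  Beside paths of at
-- least 4 vertices, P_4 is always P: it must become P_1 or P_2 while the
-- others stay non-empty.  Hence P_{11+m} is N by splitting it into P_4 and
-- P_{4+m}, and P_6, P_7, P_8 are N by moving to P_4, P_5, P_5.
module Submission where

open import Defs
open import Data.Nat using (ℕ; zero; suc; _+_; _*_; _≤_; _<_; z≤n; s≤s; _≟_)
open import Data.Nat.Properties
  using (≤-trans; +-monoʳ-≤; +-identityʳ; *-cancelˡ-<; module ≤-Reasoning)
open import Data.List using (List; []; _∷_; _++_)
open import Data.List.Relation.Unary.All using (All; []; _∷_)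
open import Data.List.Relation.Unary.All.Properties using (++⁺)
open import Data.Product using (Σ; _,_; proj₂)
open import Data.Sum using (inj₁; inj₂)
open import Data.Empty using (⊥; ⊥-elim)
open import Relation.Nullary using (¬_)
open import Relation.Nullary.Decidable using (Dec; _⊎-dec_; decidable-stable)
open import Relation.Binary.PropositionalEquality using (_≡_; refl; cong)
open import Function.Bundles using (_⇔_; mk⇔)

P-N-exclusive : ∀ {x} → IsP x → IsN x → ⊥
P-N-exclusive (p allN) (n y x→y yP) = P-N-exclusive yP (allN y x→y)

empty-P : ∀ ks → IsP (0 ∷ ks)
empty-P ks = p λ { _ (() ∷ _) }

KMove-exists : ∀ k → Σ (List ℕ) (KMove (suc k))
KMove-exists 0 = _ , k1
KMove-exists 1 = _ , k2
KMove-exists 2 = _ , k3-0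
KMove-exists (suc (suc (suc m))) = _ , k-3 m

Move-exists : ∀ {ks} → All (0 <_) ks → Σ Position (Move ks)
Move-exists [] = _ , []
Move-exists (s≤s {n = k} z≤n ∷ ks>0) =
  _ , proj₂ (KMove-exists k) ∷ proj₂ (Move-exists ks>0)

KMove-to-empty : ∀ {c} → 0 < c → c < 4 → KMove c (0 ∷ [])
KMove-to-empty {1} _ _ = k1
KMove-to-empty {2} _ _ = k2
KMove-to-empty {3} _ _ = k3-0
KMove-to-empty {suc (suc (suc (suc _)))} _ (s≤s (s≤s (s≤s (s≤s ()))))

emptiable-head-N : ∀ {c ks} → KMove c (0 ∷ []) → All (0 <_) ks → IsN (c ∷ ks)
emptiable-head-N c→0 ks>0 = n _ (c→0 ∷ proj₂ (Move-exists ks>0)) (empty-P _)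

KMove-long-positive : ∀ {k r} → 4 ≤ k → KMove k r → All (0 <_) r
KMove-long-positive _ (k-2 m) = s≤s z≤n ∷ []
KMove-long-positive _ (k-3 m) = s≤s z≤n ∷ []
KMove-long-positive _ (split m i j 0<i i≤j _) = 0<i ∷ ≤-trans 0<i i≤j ∷ []
KMove-long-positive (s≤s ()) k1
KMove-long-positive (s≤s (s≤s ())) k2
KMove-long-positive (s≤s (s≤s (s≤s ()))) k3-0
KMove-long-positive (s≤s (s≤s (s≤s ()))) k3-1

Move-long-positive : ∀ {ks rs} → All (4 ≤_) ks → Move ks rs → All (0 <_) rs
Move-long-positive [] [] = []
Move-long-positive (4≤k ∷ ks≥4) (k→r ∷ ks→rs) =
  ++⁺ (KMove-long-positive 4≤k k→r) (Move-long-positive ks≥4 ks→rs)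

four-beside-long-P : ∀ {ks} → All (4 ≤_) ks → IsP (4 ∷ ks)
four-beside-long-P ks≥4 = p λ
  { _ (k-2 0 ∷ ks→rs) → emptiable-head-N k2 (Move-long-positive ks≥4 ks→rs)
  ; _ (k-3 0 ∷ ks→rs) → emptiable-head-N k1 (Move-long-positive ks≥4 ks→rs)
  ; _ (split 0 (suc zero) (suc j) _ _ () ∷ _)
  ; _ (split 0 (suc (suc i)) (suc j) _ _ () ∷ _) }

shorter-part-of-split : ∀ {i j m} → i ≤ j → i + j ≡ suc m → m ≤ 6 → i < 4
shorter-part-of-split {i} {j} {m} i≤j i+j≡1+m m≤6 = *-cancelˡ-< 2 i 4 (begin-strict
  2 * i      ≡⟨ cong (i +_) (+-identityʳ i) ⟩
  i + i      ≤⟨ +-monoʳ-≤ i i≤j ⟩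
  i + j      ≡⟨ i+j≡1+m ⟩
  suc m      <⟨ s≤s (s≤s m≤6) ⟩
  8          ∎)
  where open ≤-Reasoning

path-P-from-shorter-N : ∀ {m} → m ≤ 6 → IsN ((2 + m) ∷ []) → IsN ((1 + m) ∷ []) →
               IsP ((4 + m) ∷ [])
path-P-from-shorter-N {m} m≤6 N₂₊ₘ N₁₊ₘ = p λ
  { _ (k-2 _ ∷ []) → N₂₊ₘ
  ; _ (k-3 _ ∷ []) → N₁₊ₘ
  ; _ (split _ i j 0<i i≤j i+j≡1+m ∷ []) →
      emptiable-head-N (KMove-to-empty 0<i (shorter-part-of-split i≤j i+j≡1+m m≤6))
                       (≤-trans 0<i i≤j ∷ []) }

emptiable-N : ∀ {k} → KMove k (0 ∷ []) → IsN (k ∷ [])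
emptiable-N k→0 = emptiable-head-N k→0 []

P₄ : IsP (4 ∷ [])
P₄ = four-beside-long-P []

P₅ : IsP (5 ∷ [])
P₅ = path-P-from-shorter-N (s≤s z≤n) (emptiable-N k3-0) (emptiable-N k2)

N₆ : IsN (6 ∷ [])
N₆ = n _ (k-2 2 ∷ []) P₄

N₇ : IsN (7 ∷ [])
N₇ = n _ (k-2 3 ∷ []) P₅

N₈ : IsN (8 ∷ [])
N₈ = n _ (k-3 4 ∷ []) P₅

P₉ : IsP (9 ∷ [])
P₉ = path-P-from-shorter-N (s≤s (s≤s (s≤s (s≤s (s≤s z≤n))))) N₇ N₆

P₁₀ : IsP (10 ∷ [])
P₁₀ = path-P-from-shorter-N (s≤s (s≤s (s≤s (s≤s (s≤s (s≤s z≤n)))))) N₈ N₇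

N₁₁₊ : ∀ m → IsN ((11 + m) ∷ [])
N₁₁₊ m = n _ (split (7 + m) 4 (4 + m) (s≤s z≤n) (s≤s (s≤s (s≤s (s≤s z≤n)))) refl ∷ [])
             (four-beside-long-P (s≤s (s≤s (s≤s (s≤s z≤n))) ∷ []))

P-positions : ∀ {k} → InL k → IsP (k ∷ [])
P-positions (inj₁ refl)                      = empty-P []
P-positions (inj₂ (inj₁ refl))               = P₄
P-positions (inj₂ (inj₂ (inj₁ refl)))        = P₅
P-positions (inj₂ (inj₂ (inj₂ (inj₁ refl)))) = P₉
P-positions (inj₂ (inj₂ (inj₂ (inj₂ refl)))) = P₁₀

N-outside-L : ∀ k → ¬ InL k → IsN (k ∷ [])
N-outside-L 0  k∉L = ⊥-elim (k∉L (inj₁ refl))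
N-outside-L 1  _   = emptiable-N k1
N-outside-L 2  _   = emptiable-N k2
N-outside-L 3  _   = emptiable-N k3-0
N-outside-L 4  k∉L = ⊥-elim (k∉L (inj₂ (inj₁ refl)))
N-outside-L 5  k∉L = ⊥-elim (k∉L (inj₂ (inj₂ (inj₁ refl))))
N-outside-L 6  _   = N₆
N-outside-L 7  _   = N₇
N-outside-L 8  _   = N₈
N-outside-L 9  k∉L = ⊥-elim (k∉L (inj₂ (inj₂ (inj₂ (inj₁ refl)))))
N-outside-L 10 k∉L = ⊥-elim (k∉L (inj₂ (inj₂ (inj₂ (inj₂ refl)))))
N-outside-L (suc (suc (suc (suc (suc (suc (suc (suc (suc (suc (suc m))))))))))) _ = N₁₁₊ m

InL? : ∀ k → Dec (InL k)
InL? k = k ≟ 0 ⊎-dec k ≟ 4 ⊎-dec k ≟ 5 ⊎-dec k ≟ 9 ⊎-dec k ≟ 10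

corollary2 : (k : ℕ) → IsP (k ∷ []) ⇔ InL k
corollary2 k = mk⇔
  (λ kP → decidable-stable (InL? k) (λ k∉L → P-N-exclusive kP (N-outside-L k k∉L)))
  P-positions
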